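{- Let $G$ be a finite simple graph that is $\alpha_1^{+}$-stable, let $v$ be the vertex with $\{v\}=\bigcap\{S:S\in\Omega(G)\}$, and let $G_0=G-N[v]$ be the subgraph induced by the vertices outside $N[v]=N(v)\cup\{v\}$. If $G$ is not $\alpha_{P_3}^{+}$-stable, then there exist vertices $x,y$ belonging to the same connected component of $G_0$ such that $\alpha(G+xv+yv)<\alpha(G)$; in other words, there is such a pair $x,y$ joined by a path avoiding $N[v]$.
   Context: $\alpha(G)$ is the maximum size of a stable set; $\Omega(G)$ is the set of maximum stable sets; $\xi(G)=|\bigcap\{S:S\in\Omega(G)\}|$. $G$ is $\alpha_1^{+}$-stable if $\xi(G)=1$. For $e\in E(\overline{G})$ (a pair of distinct non-adjacent vertices), $G+e$ denotes $G$ with $e$ added. $G$ is $\alpha_{P_3}^{+}$-stable if $\alpha(G+e_1+e_2)=\alpha(G)$ for any $e_1,e_2\in E(\overline{G})$ (not necessarily distinct) having a common endpoint. -}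

module Defs where

open import Data.Nat using (ℕ; zero; suc; _⊔_)
open import Data.Bool using (Bool; true; false; _∧_; _∨_; not; if_then_else_)
open import Data.Fin using (Fin; _≟_)
open import Data.Fin.Subset using (Subset; _∈_; ∣_∣; inside; outside)
open import Data.Vec using (_∷_; []; lookup)
open import Data.List using (List; []; _∷_; map; _++_; foldr; filter; allFin)
open import Data.Bool.ListAction using (all)
open import Data.Product using (_×_; ∃-syntax)
open import Relation.Binary.PropositionalEquality using (_≡_; _≢_)
open import Relation.Nullary.Decidable using (⌊_⌋; T?)

Graph : ℕ → Set
Graph n = Fin n → Fin n → Bool

IsSimple : ∀ {n} → Graph n → Set
IsSimple {n} G = (∀ (i j : Fin n) → G i j ≡ G j i) × (∀ (i : Fin n) → G i i ≡ false)

Stable : ∀ {n} → Graph n → Subset n → Set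
Stable {n} G S = ∀ (i j : Fin n) → i ∈ S → j ∈ S → G i j ≡ false

memᵇ : ∀ {n} → Fin n → Subset n → Bool
memᵇ i S with lookup S i
... | inside = true
... | outside = false

stableᵇ : ∀ {n} → Graph n → Subset n → Bool
stableᵇ {n} G S =
  all (λ i → all (λ j → not (memᵇ i S ∧ memᵇ j S ∧ G i j)) (allFin n)) (allFin n)

allSubsets : (n : ℕ) → List (Subset n)
allSubsets zero = [] ∷ []
allSubsets (suc n) = map (outside ∷_) (allSubsets n) ++ map (inside ∷_) (allSubsets n)

α : ∀ {n} → Graph n → ℕ
α {n} G = foldr _⊔_ 0 (map ∣_∣ (filter (λ S → T? (stableᵇ G S)) (allSubsets n)))

MaxStable : ∀ {n} → Graph n → Subset n → Set
MaxStable {n} G S = Stable G S × (∀ (T : Subset n) → Stable G T → ∣ T ∣ Data.Nat.≤ ∣ S ∣)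

InCore : ∀ {n} → Graph n → Fin n → Set
InCore {n} G u = ∀ (S : Subset n) → MaxStable G S → u ∈ S

α1⁺-stable : ∀ {n} → Graph n → Set
α1⁺-stable {n} G = ∃[ v ] (InCore G v × (∀ (u : Fin n) → InCore G u → u ≡ v))

-- G + ab : add the edge {a,b} (no effect on the diagonal, so G + aa = G).
addEdge : ∀ {n} → Graph n → Fin n → Fin n → Graph n
addEdge G a b i j =
  G i j ∨ (not ⌊ i ≟ j ⌋ ∧ ((⌊ i ≟ a ⌋ ∧ ⌊ j ≟ b ⌋) ∨ (⌊ i ≟ b ⌋ ∧ ⌊ j ≟ a ⌋)))

NonEdge : ∀ {n} → Graph n → Fin n → Fin n → Set
NonEdge G a b = a ≢ b × G a b ≡ false

-- α_{P3}^+-stability: adding any two non-edges with a common endpoint a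
-- (ab and ac, possibly b = c) does not change α.
αP3⁺-stable : ∀ {n} → Graph n → Set
αP3⁺-stable {n} G = ∀ (a b c : Fin n) → NonEdge G a b → NonEdge G a c →
  α (addEdge (addEdge G a b) a c) ≡ α G

OutsideClosedNbhd : ∀ {n} → Graph n → Fin n → Fin n → Set
OutsideClosedNbhd G v u = u ≢ v × G v u ≡ false

data ConnectedIn {n} (G : Graph n) (P : Fin n → Set) : Fin n → Fin n → Set where
  here : ∀ {x} → P x → ConnectedIn G P x x
  step : ∀ {x z y} → P x → G x z ≡ true → ConnectedIn G P z y → ConnectedIn G P x y

{-# OPTIONS --safe #-}
module Submission where

-- Adding the edges ab and ac of a P₃ lowers α exactly when every maximum stable set
-- contains a together with b or c; then a lies in the core, so a = v, while b and c are
-- distinct vertices of G₀ = G − N[v] outside the core, and α(G + bv + cv) < α(G).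
-- Let C be the set of vertices joined to c by a path in G₀. Every maximum stable set S
-- contains v, so a vertex of S outside C adjacent to C is neither v (C avoids N(v)) nor
-- a neighbour of v, hence lies in G₀ and thus in C: there is none.
-- Thus exchanging two maximum stable sets S₁, S₂ on C gives two stable sets whose sizes
-- add up to 2α, i.e. two maximum stable sets. If b ∉ C, the one equal to S₁ on C and to
-- S₂ elsewhere contains b or c, so c ∈ S₁ or b ∈ S₂ for all maximum S₁, S₂, and b or c
-- would lie in the core.

open import Defs
open import Data.Bool using (Bool; true; false; T; not; _∧_; if_then_else_)
import Data.Bool as Bool
open import Data.Bool.ListAction using (all)
open import Data.Bool.Properties using (T-not-≡)
open import Data.Empty using (⊥-elim)
open import Data.Fin using (Fin; _≟_)
open import Data.Fin.Properties using (any?)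
open import Data.Fin.Subset using (Subset; _∈_; _∉_; ∣_∣; inside; outside; ⊥; ⁅_⁆; _∪_)
open import Data.Fin.Subset.Properties
  using (_∈?_; ∉⊥; ∣⊥∣≡0; ∣p∣≤n; p⊂q⇒∣p∣<∣q∣; q⊆p∪q; x∈p∪q⁺; x∈p∪q⁻; x∈⁅x⁆; x∈⁅y⁆⇒x≡y)
open import Data.List using (List; _∷_; map; foldr; filter; allFin)
open import Data.List.Membership.Propositional using () renaming (_∈_ to _∈ₗ_)
open import Data.List.Membership.Propositional.Properties
  using (∈-map⁺; ∈-map⁻; ∈-++⁺ˡ; ∈-++⁺ʳ; ∈-filter⁺; ∈-filter⁻; ∈-allFin; foldr-selective)
import Data.List.Relation.Unary.All as All
open import Data.List.Relation.Unary.All.Properties using (all⁺; all⁻)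
import Data.List.Relation.Unary.Any as Any
open import Data.Nat using (ℕ; zero; suc; _<_; _≤_; _+_; _⊔_)
open import Data.Nat.Properties as ℕ
  using ( ≤-antisym; ≤-trans; ≤-reflexive; ≤⇒≯; <-≤-trans; ≤∧≢⇒<; m≤m+n; m≤m⊔n; m≤n⇒m≤o⊔n; ⊔-sel
        ; +-suc; +-comm; +-cancelʳ-≤; +-monoʳ-≤)
open import Data.Product using (_×_; _,_; proj₁; proj₂; map₂; swap; ∃-syntax)
import Data.Sum as Sum
open import Data.Sum using (_⊎_; inj₁; inj₂; [_,_]′)
open import Data.Vec using (_∷_; []; lookup; here; there)
open import Data.Vec.Properties using ([]=⇒lookup; lookup⇒[]=)
open import Function using (id; _∘_; Equivalence)
open import Level using (0ℓ)
open import Relation.Binary using (Rel; Decidable)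
open import Relation.Binary.Construct.Closure.ReflexiveTransitive using (Star; ε; _◅_)
open import Relation.Binary.PropositionalEquality
  using (_≡_; _≢_; refl; sym; trans; subst; cong; module ≡-Reasoning)
open import Relation.Nullary using (¬_; Dec; yes; no; ¬?)
open import Relation.Nullary.Decidable using (T?; _×-dec_; decidable-stable)

private
  variable
    n : ℕ
    G H : Graph n
    S A B C : Subset n
    a b c d i j : Fin n

∈⇒memᵇ : i ∈ S → memᵇ i S ≡ true
∈⇒memᵇ {i = i} {S = S} i∈S with lookup S i | []=⇒lookup i∈S
... | true | _ = refl

memᵇ⇒∈ : memᵇ i S ≡ true → i ∈ S
memᵇ⇒∈ {i = i} {S = S} e with lookup S i in eq
... | true = lookup⇒[]= i S eq

T-not-∧⇒≡false : ∀ {x y z} → x ≡ true → y ≡ true → T (not (x ∧ y ∧ z)) → z ≡ false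
T-not-∧⇒≡false refl refl = Equivalence.to T-not-≡

≡false⇒T-not-∧ : ∀ x y {z} → (x ≡ true → y ≡ true → z ≡ false) → T (not (x ∧ y ∧ z))
≡false⇒T-not-∧ true  true  h = Equivalence.from T-not-≡ (h refl refl)
≡false⇒T-not-∧ true  false _ = _
≡false⇒T-not-∧ false _     _ = _

stableᵇ⇒Stable : T (stableᵇ G S) → Stable G S
stableᵇ⇒Stable {n} {G} {S} t i j i∈S j∈S =
  T-not-∧⇒≡false (∈⇒memᵇ i∈S) (∈⇒memᵇ j∈S) (All.lookup (all⁺ _ _ row) (∈-allFin j))
  where
  row : T (all (λ j → not (memᵇ i S ∧ memᵇ j S ∧ G i j)) (allFin n))
  row = All.lookup (all⁺ _ _ t) (∈-allFin i)

Stable⇒stableᵇ : Stable G S → T (stableᵇ G S)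
Stable⇒stableᵇ {n} {G} {S} st =
  all⁻ row {allFin n} (All.tabulate λ {i} _ → all⁻ (entry i) {allFin n} (All.tabulate λ {j} _ →
    ≡false⇒T-not-∧ (memᵇ i S) (memᵇ j S) λ i∈S j∈S → st i j (memᵇ⇒∈ i∈S) (memᵇ⇒∈ j∈S)))
  where
  entry : Fin n → Fin n → Bool
  entry i j = not (memᵇ i S ∧ memᵇ j S ∧ G i j)
  row : Fin n → Bool
  row i = all (entry i) (allFin n)

∈-allSubsets : (S : Subset n) → S ∈ₗ allSubsets n
∈-allSubsets [] = Any.here refl
∈-allSubsets {suc n} (outside ∷ S) = ∈-++⁺ˡ (∈-map⁺ (outside ∷_) (∈-allSubsets S))
∈-allSubsets {suc n} (inside ∷ S) =
  ∈-++⁺ʳ (map (outside ∷_) (allSubsets n)) (∈-map⁺ (inside ∷_) (∈-allSubsets S))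

∈⇒≤foldr-⊔ : ∀ {k ks} → k ∈ₗ ks → k ≤ foldr _⊔_ 0 ks
∈⇒≤foldr-⊔ (Any.here refl) = m≤m⊔n _ _
∈⇒≤foldr-⊔ (Any.there k∈ks) = m≤n⇒m≤o⊔n _ (∈⇒≤foldr-⊔ k∈ks)

Stable⇒∣∣≤α : Stable G S → ∣ S ∣ ≤ α G
Stable⇒∣∣≤α {G = G} {S = S} st =
  ∈⇒≤foldr-⊔ (∈-map⁺ ∣_∣ (∈-filter⁺ (λ S → T? (stableᵇ G S)) (∈-allSubsets S) (Stable⇒stableᵇ st)))

α-attained : (G : Graph n) → ∃[ S ] (Stable G S × ∣ S ∣ ≡ α G)
α-attained {n} G = attained (foldr-selective ⊔-sel 0 sizes)
  where
  stable? : (S : Subset n) → Dec (T (stableᵇ G S))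
  stable? S = T? (stableᵇ G S)
  sizes : List ℕ
  sizes = map ∣_∣ (filter stable? (allSubsets n))
  attained : α G ≡ 0 ⊎ α G ∈ₗ sizes → ∃[ S ] (Stable G S × ∣ S ∣ ≡ α G)
  attained (inj₁ α≡0) = ⊥ , (λ _ _ i∈⊥ _ → ⊥-elim (∉⊥ i∈⊥)) , trans (∣⊥∣≡0 n) (sym α≡0)
  attained (inj₂ α∈sizes) with ∈-map⁻ ∣_∣ α∈sizes
  ... | S , S∈stables , α≡∣S∣ =
    S , stableᵇ⇒Stable (proj₂ (∈-filter⁻ stable? {xs = allSubsets n} S∈stables)) , sym α≡∣S∣

MaxStable⇒∣∣≡α : MaxStable G S → ∣ S ∣ ≡ α G
MaxStable⇒∣∣≡α {G = G} (st , maxS) with α-attained G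
... | S′ , stS′ , ∣S′∣≡α = ≤-antisym (Stable⇒∣∣≤α st) (subst (_≤ _) ∣S′∣≡α (maxS S′ stS′))

∣∣≡α⇒MaxStable : Stable G S → ∣ S ∣ ≡ α G → MaxStable G S
∣∣≡α⇒MaxStable st ∣S∣≡α = st , λ S′ stS′ → subst (_ ≤_) (sym ∣S∣≡α) (Stable⇒∣∣≤α stS′)

_⊆ᴱ_ : Graph n → Graph n → Set
_⊆ᴱ_ {n} G H = ∀ (i j : Fin n) → G i j ≡ true → H i j ≡ true

Stable-antitone : G ⊆ᴱ H → Stable H S → Stable G S
Stable-antitone {G = G} G⊆H st i j i∈S j∈S with G i j in eq
... | false = refl
... | true with () ← trans (sym (G⊆H i j eq)) (st i j i∈S j∈S)

α-antitone : G ⊆ᴱ H → α H ≤ α G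
α-antitone {H = H} G⊆H with α-attained H
... | S , st , ∣S∣≡α = subst (_≤ _) ∣S∣≡α (Stable⇒∣∣≤α (Stable-antitone G⊆H st))

α-preserved : G ⊆ᴱ H → MaxStable G S → Stable H S → α H ≡ α G
α-preserved G⊆H maxS stH =
  ≤-antisym (α-antitone G⊆H) (subst (_≤ _) (MaxStable⇒∣∣≡α maxS) (Stable⇒∣∣≤α stH))

⊆ᴱ-addEdge : (G : Graph n) (a b : Fin n) → G ⊆ᴱ addEdge G a b
⊆ᴱ-addEdge G a b i j Gij rewrite Gij = refl

addEdge-adjacent : (G : Graph n) → a ≢ b → addEdge G a b a b ≡ true
addEdge-adjacent {a = a} {b} G a≢b with G a b | a ≟ b | a ≟ a | b ≟ b
... | true  | _        | _        | _        = refl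
... | false | yes a≡b  | _        | _        = ⊥-elim (a≢b a≡b)
... | false | no _     | yes _    | yes _    = refl
... | false | no _     | no a≢a   | _        = ⊥-elim (a≢a refl)
... | false | no _     | yes _    | no b≢b   = ⊥-elim (b≢b refl)

addEdge⁻ : (G : Graph n) → addEdge G a b i j ≡ true →
  G i j ≡ true ⊎ (i ≡ a × j ≡ b) ⊎ (i ≡ b × j ≡ a)
addEdge⁻ {a = a} {b} {i} {j} G e with G i j | i ≟ j | i ≟ a | j ≟ b | i ≟ b | j ≟ a
... | true  | _     | _       | _       | _       | _       = inj₁ refl
... | false | yes _ | _       | _       | _       | _       with () ← e
... | false | no _  | yes i≡a | yes j≡b | _       | _       = inj₂ (inj₁ (i≡a , j≡b))
... | false | no _  | _       | _       | yes i≡b | yes j≡a = inj₂ (inj₂ (i≡b , j≡a))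
... | false | no _  | yes _   | no _    | yes _   | no _    with () ← e
... | false | no _  | yes _   | no _    | no _    | _       with () ← e
... | false | no _  | no _    | _       | yes _   | no _    with () ← e
... | false | no _  | no _    | _       | no _    | _       with () ← e

Stable-addEdge : Stable G S → ¬ (a ∈ S × b ∈ S) → Stable (addEdge G a b) S
Stable-addEdge {G = G} {a = a} {b} st ¬ab i j i∈S j∈S with addEdge G a b i j in eq
... | false = refl
... | true with addEdge⁻ G eq
...   | inj₁ Gij with () ← trans (sym Gij) (st i j i∈S j∈S)
...   | inj₂ (inj₁ (refl , refl)) = ⊥-elim (¬ab (i∈S , j∈S))
...   | inj₂ (inj₂ (refl , refl)) = ⊥-elim (¬ab (j∈S , i∈S))

⊆ᴱ-addEdge₂ : (G : Graph n) (a b c d : Fin n) → G ⊆ᴱ addEdge (addEdge G a b) c d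
⊆ᴱ-addEdge₂ G a b c d i j Gij = ⊆ᴱ-addEdge (addEdge G a b) c d i j (⊆ᴱ-addEdge G a b i j Gij)

MaxStable-spans-addedEdge : α (addEdge (addEdge G a b) c d) ≢ α G → MaxStable G S →
  (a ∈ S × b ∈ S) ⊎ (c ∈ S × d ∈ S)
MaxStable-spans-addedEdge {G = G} {a} {b} {c} {d} {S} α≢ maxS
  with a ∈? S ×-dec b ∈? S | c ∈? S ×-dec d ∈? S
... | yes ab | _      = inj₁ ab
... | no _   | yes cd = inj₂ cd
... | no ¬ab | no ¬cd = ⊥-elim (α≢ (α-preserved (⊆ᴱ-addEdge₂ G a b c d) maxS
                          (Stable-addEdge (Stable-addEdge (proj₁ maxS) ¬ab) ¬cd)))

α-addEdge₂-< : a ≢ b → c ≢ d → (∀ S → MaxStable G S → (a ∈ S × b ∈ S) ⊎ (c ∈ S × d ∈ S)) →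
  α (addEdge (addEdge G a b) c d) < α G
α-addEdge₂-< {a = a} {b} {c} {d} {G} a≢b c≢d spans = ≤∧≢⇒< (α-antitone G⊆G⁺) α≢
  where
  G⁺ : Graph _
  G⁺ = addEdge (addEdge G a b) c d
  G⊆G⁺ : G ⊆ᴱ G⁺
  G⊆G⁺ = ⊆ᴱ-addEdge₂ G a b c d
  α≢ : α G⁺ ≢ α G
  α≢ α≡ with α-attained G⁺
  ... | S , stH , ∣S∣≡α with spans S (∣∣≡α⇒MaxStable (Stable-antitone G⊆G⁺ stH) (trans ∣S∣≡α α≡))
  ...   | inj₁ (a∈S , b∈S) with () ← trans (sym (⊆ᴱ-addEdge (addEdge G a b) c d a b (addEdge-adjacent G a≢b))) (stH a b a∈S b∈S)
  ...   | inj₂ (c∈S , d∈S) with () ← trans (sym (addEdge-adjacent (addEdge G a b) c≢d)) (stH c d c∈S d∈S)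

splice : Subset n → Subset n → Subset n → Subset n
splice []      []      []      = []
splice (x ∷ C) (s ∷ A) (t ∷ B) = (if x then s else t) ∷ splice C A B

∈-splice⁻ : ∀ (C A B : Subset n) → i ∈ splice C A B → (i ∈ C × i ∈ A) ⊎ (i ∉ C × i ∈ B)
∈-splice⁻ (inside  ∷ C) (inside ∷ A) (_      ∷ B) here = inj₁ (here , here)
∈-splice⁻ (outside ∷ C) (_      ∷ A) (inside ∷ B) here = inj₂ ((λ ()) , here)
∈-splice⁻ (_       ∷ C) (_      ∷ A) (_      ∷ B) (there i∈S) with ∈-splice⁻ C A B i∈S
... | inj₁ (i∈C , i∈A) = inj₁ (there i∈C , there i∈A)
... | inj₂ (i∉C , i∈B) = inj₂ ((λ { (there i∈C) → i∉C i∈C }) , there i∈B)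

∈-splice⁻ˡ : i ∈ C → i ∈ splice C A B → i ∈ A
∈-splice⁻ˡ {C = C} {A} {B} i∈C i∈S with ∈-splice⁻ C A B i∈S
... | inj₁ (_   , i∈A) = i∈A
... | inj₂ (i∉C , _)   = ⊥-elim (i∉C i∈C)

∈-splice⁻ʳ : i ∉ C → i ∈ splice C A B → i ∈ B
∈-splice⁻ʳ {C = C} {A} {B} i∉C i∈S with ∈-splice⁻ C A B i∈S
... | inj₁ (i∈C , _)   = ⊥-elim (i∉C i∈C)
... | inj₂ (_   , i∈B) = i∈B

∣∷∣+∣∷∣ : ∀ s t (p q p′ q′ : Subset n) → ∣ p ∣ + ∣ q ∣ ≡ ∣ p′ ∣ + ∣ q′ ∣ →
  ∣ s ∷ p ∣ + ∣ t ∷ q ∣ ≡ ∣ s ∷ p′ ∣ + ∣ t ∷ q′ ∣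
∣∷∣+∣∷∣ outside outside _ _ _ _ e = e
∣∷∣+∣∷∣ inside  outside _ _ _ _ e = cong suc e
∣∷∣+∣∷∣ outside inside  p q p′ q′ e = begin
  ∣ p ∣ + suc ∣ q ∣    ≡⟨ +-suc (∣ p ∣) (∣ q ∣) ⟩
  suc (∣ p ∣ + ∣ q ∣)  ≡⟨ cong suc e ⟩
  suc (∣ p′ ∣ + ∣ q′ ∣) ≡⟨ sym (+-suc (∣ p′ ∣) (∣ q′ ∣)) ⟩
  ∣ p′ ∣ + suc ∣ q′ ∣  ∎
  where open ≡-Reasoning
∣∷∣+∣∷∣ inside  inside  p q p′ q′ e = cong suc (∣∷∣+∣∷∣ outside inside p q p′ q′ e)

∣splice∣+∣splice∣ : ∀ (C A B : Subset n) → ∣ splice C A B ∣ + ∣ splice C B A ∣ ≡ ∣ A ∣ + ∣ B ∣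
∣splice∣+∣splice∣ []            []      []      = refl
∣splice∣+∣splice∣ (inside  ∷ C) (s ∷ A) (t ∷ B) =
  ∣∷∣+∣∷∣ s t (splice C A B) (splice C B A) A B (∣splice∣+∣splice∣ C A B)
∣splice∣+∣splice∣ (outside ∷ C) (s ∷ A) (t ∷ B) = trans
  (∣∷∣+∣∷∣ t s (splice C A B) (splice C B A) B A (trans (∣splice∣+∣splice∣ C A B) (+-comm (∣ A ∣) (∣ B ∣))))
  (+-comm (∣ t ∷ B ∣) (∣ s ∷ A ∣))

Separated : Graph n → Subset n → Subset n → Set
Separated {n} G C S = ∀ {i j : Fin n} → i ∈ C → j ∉ C → j ∈ S → G i j ≡ false

Stable-splice : (∀ i j → G i j ≡ G j i) → Stable G A → Stable G B → Separated G C B →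
  Stable G (splice C A B)
Stable-splice {G = G} {A} {B} {C} G-sym stA stB sepB i j i∈S j∈S
  with ∈-splice⁻ C A B i∈S | ∈-splice⁻ C A B j∈S
... | inj₁ (_   , i∈A) | inj₁ (_   , j∈A) = stA i j i∈A j∈A
... | inj₂ (_   , i∈B) | inj₂ (_   , j∈B) = stB i j i∈B j∈B
... | inj₁ (i∈C , _)   | inj₂ (j∉C , j∈B) = sepB i∈C j∉C j∈B
... | inj₂ (i∉C , i∈B) | inj₁ (j∈C , _)   = trans (G-sym i j) (sepB j∈C i∉C i∈B)

MaxStable-splice : (∀ i j → G i j ≡ G j i) → MaxStable G A → MaxStable G B →
  Separated G C A → Separated G C B → MaxStable G (splice C A B)
MaxStable-splice {G = G} {A} {B} {C} G-sym (stA , maxA) (stB , maxB) sepA sepB =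
  stS₁ , λ U stU → ≤-trans (maxA U stU) ∣A∣≤∣S₁∣
  where
  S₁ S₂ : Subset _
  S₁ = splice C A B
  S₂ = splice C B A
  stS₁ : Stable G S₁
  stS₁ = Stable-splice G-sym stA stB sepB
  ∣A∣≤∣S₁∣ : ∣ A ∣ ≤ ∣ S₁ ∣
  ∣A∣≤∣S₁∣ = +-cancelʳ-≤ (∣ B ∣) (∣ A ∣) (∣ S₁ ∣) (begin
    ∣ A ∣ + ∣ B ∣  ≡⟨ sym (∣splice∣+∣splice∣ C A B) ⟩
    ∣ S₁ ∣ + ∣ S₂ ∣ ≤⟨ +-monoʳ-≤ ∣ S₁ ∣ (maxB S₂ (Stable-splice G-sym stB stA sepA)) ⟩
    ∣ S₁ ∣ + ∣ B ∣  ∎)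
    where open ℕ.≤-Reasoning

BackwardClosed : Rel (Fin n) 0ℓ → Subset n → Set
BackwardClosed R C = ∀ {i j} → R i j → j ∈ C → i ∈ C

Reachers : Rel (Fin n) 0ℓ → Fin n → Subset n → Set
Reachers R c C = c ∈ C × BackwardClosed R C × (∀ {i} → i ∈ C → Star R i c)

module _ {R : Rel (Fin n) 0ℓ} (R? : Decidable R) (c : Fin n) where

  private
    Frontier : Subset n → Set
    Frontier C = ∃[ i ] ∃[ j ] (i ∉ C × R i j × j ∈ C)

    frontier? : ∀ C → Dec (Frontier C)
    frontier? C = any? λ i → any? λ j → ¬? (i ∈? C) ×-dec R? i j ×-dec j ∈? C

    ¬Frontier⇒BackwardClosed : ¬ Frontier C → BackwardClosed R C
    ¬Frontier⇒BackwardClosed {C} ¬F {i} {j} r j∈C with i ∈? C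
    ... | yes i∈C = i∈C
    ... | no  i∉C = ⊥-elim (¬F (i , j , i∉C , r , j∈C))

    grow : ∀ k C → n ≤ k + ∣ C ∣ → c ∈ C → (∀ {i} → i ∈ C → Star R i c) → ∃[ C′ ] Reachers R c C′
    grow k C bound c∈C reach with frontier? C
    ... | no ¬F = C , c∈C , ¬Frontier⇒BackwardClosed ¬F , reach
    ... | yes (i , j , i∉C , r , j∈C) = add k bound
      where
      C′ : Subset n
      C′ = ⁅ i ⁆ ∪ C
      ∣C∣<∣C′∣ : ∣ C ∣ < ∣ C′ ∣
      ∣C∣<∣C′∣ = p⊂q⇒∣p∣<∣q∣ (q⊆p∪q ⁅ i ⁆ C , i , x∈p∪q⁺ (inj₁ (x∈⁅x⁆ i)) , i∉C)
      reach′ : ∀ {x} → x ∈ C′ → Star R x c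
      reach′ x∈C′ with x∈p∪q⁻ ⁅ i ⁆ C x∈C′
      ... | inj₁ x∈⁅i⁆ rewrite x∈⁅y⁆⇒x≡y i x∈⁅i⁆ = r ◅ reach j∈C
      ... | inj₂ x∈C = reach x∈C
      add : ∀ k → n ≤ k + ∣ C ∣ → ∃[ C″ ] Reachers R c C″
      add zero    n≤∣C∣ = ⊥-elim (≤⇒≯ n≤∣C∣ (<-≤-trans ∣C∣<∣C′∣ (∣p∣≤n C′)))
      add (suc k) bound = grow k C′ bound′ (x∈p∪q⁺ (inj₂ c∈C)) reach′
        where
        bound′ : n ≤ k + ∣ C′ ∣
        bound′ = ≤-trans bound (≤-trans (≤-reflexive (sym (+-suc k (∣ C ∣)))) (+-monoʳ-≤ k ∣C∣<∣C′∣))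

  reachers : ∃[ C ] Reachers R c C
  reachers = grow n ⁅ c ⁆ (m≤m+n n _) (x∈⁅x⁆ c) reach⁅c⁆
    where
    reach⁅c⁆ : ∀ {i} → i ∈ ⁅ c ⁆ → Star R i c
    reach⁅c⁆ i∈⁅c⁆ rewrite x∈⁅y⁆⇒x≡y c i∈⁅c⁆ = ε

EdgeFrom : Graph n → (Fin n → Set) → Rel (Fin n) 0ℓ
EdgeFrom G P i j = P i × G i j ≡ true

Star⇒ConnectedIn : ∀ {P : Fin n → Set} {x y} → P y → Star (EdgeFrom G P) x y → ConnectedIn G P x y
Star⇒ConnectedIn Py ε               = here Py
Star⇒ConnectedIn Py ((Px , Gxz) ◅ s) = step Px Gxz (Star⇒ConnectedIn Py s)

ConnectedIn-source : ∀ {P : Fin n → Set} {x y} → ConnectedIn G P x y → P x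
ConnectedIn-source (here Px)     = Px
ConnectedIn-source (step Px _ _) = Px

Reachers-EdgeFrom⊆ : ∀ {P : Fin n → Set} → P c → Reachers (EdgeFrom G P) c C → i ∈ C → P i
Reachers-EdgeFrom⊆ Pc (_ , _ , reach) i∈C = ConnectedIn-source (Star⇒ConnectedIn Pc (reach i∈C))

outsideClosedNbhd? : (G : Graph n) (v u : Fin n) → Dec (OutsideClosedNbhd G v u)
outsideClosedNbhd? G v u = ¬? (u ≟ v) ×-dec (G v u Bool.≟ false)

module _ {G : Graph n} (G-sym : ∀ i j → G i j ≡ G j i) {v : Fin n} where

  private
    G₀-edge : Rel (Fin n) 0ℓ
    G₀-edge = EdgeFrom G (OutsideClosedNbhd G v)

    G₀-edge? : Decidable G₀-edge
    G₀-edge? i j = outsideClosedNbhd? G v i ×-dec (G i j Bool.≟ true)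

  Reachers-separated : OutsideClosedNbhd G v c → Reachers G₀-edge c C →
    MaxStable G S → v ∈ S → Separated G C S
  Reachers-separated {c} {C} {S} G₀c reachersC@(_ , closed , _) (stS , _) v∈S {i} {j} i∈C j∉C j∈S
    with G i j in Gij | j ≟ v
  ... | false | _        = refl
  ... | true  | yes refl
    with () ← trans (sym Gij) (trans (G-sym i v) (proj₂ (Reachers-EdgeFrom⊆ G₀c reachersC i∈C)))
  ... | true  | no j≢v   =
    ⊥-elim (j∉C (closed ((j≢v , stS v j v∈S j∈S) , trans (G-sym j i) Gij) i∈C))

  forced-connected : OutsideClosedNbhd G v c → ¬ InCore G b → ¬ InCore G c →
    (∀ S → MaxStable G S → v ∈ S × (b ∈ S ⊎ c ∈ S)) → ConnectedIn G (OutsideClosedNbhd G v) b c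
  forced-connected {c} {b} G₀c ¬core-b ¬core-c forced with reachers G₀-edge? c
  ... | C , reachersC@(c∈C , _ , reach) with b ∈? C
  ...   | yes b∈C = Star⇒ConnectedIn G₀c (reach b∈C)
  ...   | no  b∉C = ⊥-elim (¬core-c λ S₁ max₁ → decidable-stable (c ∈? S₁) λ c∉S₁ →
                      ¬core-b λ S₂ max₂ → [ ⊥-elim ∘ c∉S₁ , id ]′ (exchange max₁ max₂))
    where
    separated : MaxStable G S → Separated G C S
    separated maxS = Reachers-separated G₀c reachersC maxS (proj₁ (forced _ maxS))
    exchange : ∀ {S₁ S₂} → MaxStable G S₁ → MaxStable G S₂ → c ∈ S₁ ⊎ b ∈ S₂
    exchange max₁ max₂ = Sum.swap (Sum.map (∈-splice⁻ʳ b∉C) (∈-splice⁻ˡ c∈C)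
      (proj₂ (forced _ (MaxStable-splice G-sym max₁ max₂ (separated max₁) (separated max₂)))))

P3-violation : Graph n → Fin n → Fin n → Fin n → Set
P3-violation G a b c = NonEdge G a b × NonEdge G a c × α (addEdge (addEdge G a b) a c) ≢ α G

¬αP3⁺-stable⇒violation : ¬ αP3⁺-stable G → ∃[ a ] ∃[ b ] ∃[ c ] P3-violation G a b c
¬αP3⁺-stable⇒violation {G = G} ¬stable =
  decidable-stable violation? λ ¬violation → ¬stable λ a b c ab ac →
    decidable-stable (α≟α a b c) λ α≢ → ¬violation (a , b , c , ab , ac , α≢)
  where
  nonEdge? : ∀ a b → Dec (NonEdge G a b)
  nonEdge? a b = ¬? (a ≟ b) ×-dec (G a b Bool.≟ false)
  α≟α : ∀ a b c → Dec (α (addEdge (addEdge G a b) a c) ≡ α G)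
  α≟α a b c = α (addEdge (addEdge G a b) a c) ℕ.≟ α G
  violation? : Dec (∃[ a ] ∃[ b ] ∃[ c ] P3-violation G a b c)
  violation? = any? λ a → any? λ b → any? λ c → nonEdge? a b ×-dec nonEdge? a c ×-dec ¬? (α≟α a b c)

InCore-unique : α1⁺-stable G → InCore G a → InCore G b → a ≡ b
InCore-unique (_ , _ , ≡w) core-a core-b = trans (≡w _ core-a) (sym (≡w _ core-b))

proposition5 : ∀ {n : ℕ} (G : Graph n) → IsSimple G → α1⁺-stable G →
    ∀ (v : Fin n) → InCore G v → ¬ αP3⁺-stable G →
    ∃[ x ] ∃[ y ] (x ≢ y × OutsideClosedNbhd G v x × OutsideClosedNbhd G v y ×
      ConnectedIn G (OutsideClosedNbhd G v) x y ×
      α (addEdge (addEdge G x v) y v) < α G)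
proposition5 G (G-sym , _) ξ≡1 v core-v ¬P3 with ¬αP3⁺-stable⇒violation ¬P3
... | a , b , c , (a≢b , Gab) , (a≢c , Gac) , α≢
  with InCore-unique ξ≡1 (λ S maxS → [ proj₁ , proj₁ ]′ (MaxStable-spans-addedEdge α≢ maxS)) core-v
... | refl = b , c , b≢c , G₀b , G₀c , forced-connected G-sym G₀c ¬core-b ¬core-c forced , α<
  where
  forced : ∀ S → MaxStable G S → a ∈ S × (b ∈ S ⊎ c ∈ S)
  forced S maxS = [ map₂ inj₁ , map₂ inj₂ ]′ (MaxStable-spans-addedEdge α≢ maxS)
  G₀b : OutsideClosedNbhd G a b
  G₀b = a≢b ∘ sym , Gab
  G₀c : OutsideClosedNbhd G a c
  G₀c = a≢c ∘ sym , Gac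
  ¬core-b : ¬ InCore G b
  ¬core-b core-b = a≢b (InCore-unique ξ≡1 core-v core-b)
  ¬core-c : ¬ InCore G c
  ¬core-c core-c = a≢c (InCore-unique ξ≡1 core-v core-c)
  b≢c : b ≢ c
  b≢c refl = ¬core-b λ S maxS → [ id , id ]′ (proj₂ (forced S maxS))
  α< : α (addEdge (addEdge G b a) c a) < α G
  α< = α-addEdge₂-< (proj₁ G₀b) (proj₁ G₀c) λ S maxS → Sum.map swap swap (MaxStable-spans-addedEdge α≢ maxS)
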